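{- Let $p>0$ be an integer and let $f$ be a rational function on a metric graph $\Gamma$ that has at most $p$ poles counted with multiplicity (i.e.\ $\sum_{P:\operatorname{ord}_Pf<0}(-\operatorname{ord}_Pf)\le p$). Then the absolute value of the slope of $f$ at any point of $\Gamma$ which is not a vertex and at which $f$ is differentiable is bounded by a number depending only on $p$ and the underlying (non-metric) graph of $\Gamma$.
   Context: A graph is a finite connected multigraph, possibly with loops. A metric graph is a graph with a length function $l:E(\Gamma)\to\mathbb{R}_{>0}$, each edge identified with $[0,l(e)]$; $\Gamma$ also denotes the glued metric space. A rational function is a continuous $f:\Gamma\to\mathbb{R}$ which on each edge is piecewise linear with integer slopes and finitely many pieces. For $P\in\Gamma$, $\operatorname{ord}_Pf$ is the sum of the outgoing slopes of $f$ along all segments of $\Gamma$ emanating from $P$. -}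

module Defs where

open import Level using (0ℓ)
open import Data.Nat as ℕ using (ℕ; zero; suc)
open import Data.Integer as ℤ using (ℤ; +_; -[1+_])
open import Data.Fin using (Fin; zero; suc)
open import Data.List using (List; []; _∷_)
open import Data.List.Relation.Unary.All using (All)
open import Data.Product using (_×_; _,_; ∃; Σ)
open import Data.Sum using (_⊎_)
open import Relation.Binary.PropositionalEquality using (_≡_; _≢_)
open import Relation.Binary.Structures using (IsStrictTotalOrder)
open import Relation.Nullary using (¬_)
open import Relation.Nullary.Decidable using (does)
open import Data.Fin.Properties using () renaming (_≟_ to _≟F_)
open import Data.Bool using (if_then_else_)
open import Algebra.Structures using (IsCommutativeRing)

-- The real numbers, given axiomatically as a complete ordered field
-- (with propositional equality).  Any model is (classically) ℝ.

record RealNumbers : Set₁ where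
  infixl 6 _+_
  infixl 7 _*_
  infix  4 _<_ _≤_
  field
    Carrier : Set
    _+_ _*_ : Carrier → Carrier → Carrier
    -_      : Carrier → Carrier
    0# 1#   : Carrier
    isCommutativeRing : IsCommutativeRing _≡_ _+_ _*_ -_ 0# 1#
    _<_     : Carrier → Carrier → Set
    isStrictTotalOrder : IsStrictTotalOrder _≡_ _<_
    0<1     : 0# < 1#
    +-mono-< : ∀ {x y} z → x < y → x + z < y + z
    *-pos    : ∀ {x y} → 0# < x → 0# < y → 0# < x * y
    inverse  : ∀ x → x ≢ 0# → Σ Carrier (λ y → x * y ≡ 1#)

  _≤_ : Carrier → Carrier → Set
  x ≤ y = x < y ⊎ x ≡ y

  field
    sup : (P : Carrier → Set) → ∃ P → ∃ (λ b → ∀ x → P x → x ≤ b) →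
          ∃ (λ s → (∀ x → P x → x ≤ s) × (∀ b → (∀ x → P x → x ≤ b) → s ≤ b))

  _-_ : Carrier → Carrier → Carrier
  x - y = x + (- y)

  fromℕ : ℕ → Carrier
  fromℕ zero    = 0#
  fromℕ (suc n) = 1# + fromℕ n

  fromℤ : ℤ → Carrier
  fromℤ (+ n)     = fromℕ n
  fromℤ -[1+ n ]  = - fromℕ (suc n)

sumℕ : ∀ {n} → (Fin n → ℕ) → ℕ
sumℕ {zero}  f = 0
sumℕ {suc n} f = f zero ℕ.+ sumℕ (λ i → f (suc i))

sumℤ : ∀ {n} → (Fin n → ℤ) → ℤ
sumℤ {zero}  f = + 0
sumℤ {suc n} f = f zero ℤ.+ sumℤ (λ i → f (suc i))

-- the number of poles contributed by an order: max(0, -ord)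
negPart : ℤ → ℕ
negPart (+ _)     = 0
negPart -[1+ n ]  = suc n

-- Graphs: finite multigraphs with loops, vertices Fin V, edges Fin E,
-- each edge oriented from src to tgt (loops: src ≡ tgt).

record Graph : Set where
  field
    V E : ℕ
    src tgt : Fin E → Fin V

module _ (G : Graph) where
  open Graph G

  data Reach : Fin V → Fin V → Set where
    here : ∀ {v} → Reach v v
    fwd  : ∀ {u} e → Reach (tgt e) u → Reach (src e) u
    bwd  : ∀ {u} e → Reach (src e) u → Reach (tgt e) u

  Connected : Set
  Connected = ∀ u v → Reach u v

module _ (R : RealNumbers) where
  open RealNumbers R

  -- a piece of a piecewise linear function on an edge:
  -- (length of the segment, integer slope)
  Pieces : Set
  Pieces = List (Carrier × ℤ)

  totalLength : Pieces → Carrier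
  totalLength []            = 0#
  totalLength ((δ , _) ∷ ps) = δ + totalLength ps

  increment : Pieces → Carrier
  increment []            = 0#
  increment ((δ , s) ∷ ps) = fromℤ s * δ + increment ps

  firstSlope : Pieces → ℤ
  firstSlope []            = + 0
  firstSlope ((_ , s) ∷ _) = s

  lastSlope : Pieces → ℤ
  lastSlope []                 = + 0
  lastSlope ((_ , s) ∷ [])     = s
  lastSlope (_ ∷ p ∷ ps)       = lastSlope (p ∷ ps)

  -- poles at the interior breakpoints of an edge: the order at the
  -- breakpoint between slopes s and s' is s' - s
  interiorPoles : Pieces → ℕ
  interiorPoles []                       = 0
  interiorPoles (_ ∷ [])                 = 0
  interiorPoles ((_ , s) ∷ (δ' , s') ∷ ps) =
    negPart (s' ℤ.- s) ℕ.+ interiorPoles ((δ' , s') ∷ ps)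

  -- DiffSlope ps x s : the function described by ps on [0, totalLength ps]
  -- is differentiable at the interior point x (0 < x < totalLength ps)
  -- with slope s (w.r.t. the edge parametrisation).
  data DiffSlope : Pieces → Carrier → ℤ → Set where
    inside : ∀ {δ s ps x} → 0# < x → x < δ → DiffSlope ((δ , s) ∷ ps) x s
    break  : ∀ {δ δ' s ps x} → x ≡ δ →
             DiffSlope ((δ , s) ∷ (δ' , s) ∷ ps) x s
    later  : ∀ {δ s' ps x s} → δ < x → DiffSlope ps (x - δ) s →
             DiffSlope ((δ , s') ∷ ps) x s

  record MetricGraph : Set where
    field
      graph  : Graph
      length : Fin (Graph.E graph) → Carrier
      length-pos : ∀ e → 0# < length e

  -- A rational function on a metric graph: values at the vertices and,
  -- on each edge e ≅ [0, l(e)], finitely many linear pieces of positive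
  -- length with integer slopes, glued continuously.
  record RationalFunction (Γ : MetricGraph) : Set where
    open MetricGraph Γ
    open Graph graph
    field
      value   : Fin V → Carrier
      pieces  : Fin E → Pieces
      pieces-pos   : ∀ e → All (λ p → 0# < Data.Product.proj₁ p) (pieces e)
      pieces-cover : ∀ e → totalLength (pieces e) ≡ length e
      continuous   : ∀ e → value (tgt e) ≡ value (src e) + increment (pieces e)

  module _ {Γ : MetricGraph} (f : RationalFunction Γ) where
    open MetricGraph Γ
    open Graph graph
    open RationalFunction f

    -- ord_v f at a vertex: sum of outgoing slopes along all emanating segments
    ordVertex : Fin V → ℤ
    ordVertex v = sumℤ (λ e →
      (if does (src e ≟F v) then firstSlope (pieces e) else + 0) ℤ.+
      (if does (tgt e ≟F v) then ℤ.- lastSlope (pieces e) else + 0))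

    numPoles : ℕ
    numPoles = sumℕ (λ v → negPart (ordVertex v)) ℕ.+
               sumℕ (λ e → interiorPoles (pieces e))

    SlopeAt : Fin E → Carrier → ℤ → Set
    SlopeAt e x s = DiffSlope (pieces e) x s

-- Fix a level c and give each linear piece of f of slope σ the weight −|σ| if it crosses
-- the level c (from below when σ > 0, from above when σ < 0) and 0 otherwise. Every piece
-- through a point of slope s gets weight −|s| for c its lower endpoint value. Summed over all
-- pieces, the weights telescope to Σ_P [f(P) > c]·ord_P f, which is at least minus the number
-- of poles. Hence |s| is bounded by the number of poles, whatever the graph.
module Submission where

open import Defs
open import Data.Nat using (ℕ; _≤_; _>_)
open import Data.Integer using (ℤ; ∣_∣)
open import Data.Product using (∃)
open import Relation.Binary.PropositionalEquality using (_≡_)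

open import Level using (0ℓ)
open import Algebra.Bundles using (Ring)
open import Algebra.Structures using (IsCommutativeRing)
import Algebra.Properties.Ring as RingProperties
open import Data.Bool using (Bool; true; false; T; if_then_else_)
open import Data.Empty using (⊥-elim)
open import Data.Fin using (Fin; zero; suc)
open import Data.Fin.Properties using () renaming (_≟_ to _≟F_)
open import Data.Integer as ℤ using (+_; +[1+_]; -[1+_]; 0ℤ; 1ℤ; _+_; _*_; -_; _-_; -≤+)
import Data.Nat.Properties as ℕP
open import Data.Integer.Properties as ℤP using (≤-refl; +-mono-≤)
open import Data.Integer.Solver using (module +-*-Solver)
open import Data.List using ([]; _∷_)
open import Data.List.Relation.Unary.All using (All; []; _∷_)
open import Data.Product using (_,_; proj₁)
open import Function using (_∘_)
open import Relation.Binary.PropositionalEquality using (refl; sym; trans; cong; cong₂; subst; subst₂; module ≡-Reasoning)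
open import Relation.Binary.Structures using (IsStrictTotalOrder)
open import Relation.Nullary using (does; yes; no)
open import Relation.Nullary.Decidable using (True; isYes; toWitness; fromWitness)

open import Algebra.Properties.CommutativeMonoid.Sum ℤP.+-0-commutativeMonoid
  using (sum; sum-cong-≗; sum-replicate-zero; ∑-comm; ∑-distrib-+)
open import Algebra.Properties.Semiring.Sum ℤP.+-*-semiring using (*-distribˡ-sum)

⟦_⟧ : Bool → ℤ
⟦ true ⟧  = 1ℤ
⟦ false ⟧ = 0ℤ

⟦⟧-diff*pos≤0 : ∀ {b b′} n → (T b → T b′) → (⟦ b ⟧ - ⟦ b′ ⟧) * + n ℤ.≤ 0ℤ
⟦⟧-diff*pos≤0 {true}  {true}  n _ = ≤-refl
⟦⟧-diff*pos≤0 {true}  {false} n b⇒b′ = ⊥-elim (b⇒b′ _)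
⟦⟧-diff*pos≤0 {false} {true}  n _ = subst (ℤ._≤ 0ℤ) (sym (ℤP.-1*i≡-i (+ n))) ℤP.neg-≤-pos
⟦⟧-diff*pos≤0 {false} {false} n _ = ≤-refl

⟦⟧-diff*neg≤0 : ∀ {b b′} n → (T b′ → T b) → (⟦ b ⟧ - ⟦ b′ ⟧) * -[1+ n ] ℤ.≤ 0ℤ
⟦⟧-diff*neg≤0 {true}  {true}  n _ = ≤-refl
⟦⟧-diff*neg≤0 {true}  {false} n _ = subst (ℤ._≤ 0ℤ) (sym (ℤP.*-identityˡ -[1+ n ])) -≤+
⟦⟧-diff*neg≤0 {false} {true}  n b′⇒b = ⊥-elim (b′⇒b _)
⟦⟧-diff*neg≤0 {false} {false} n _ = ≤-refl

⟦⟧*≥-negPart : ∀ b z → - + negPart z ℤ.≤ ⟦ b ⟧ * z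
⟦⟧*≥-negPart true  (+ n)    = subst (- + 0 ℤ.≤_) (sym (ℤP.*-identityˡ (+ n))) (ℤP.neg-≤-pos {0})
⟦⟧*≥-negPart true  -[1+ n ] = ℤP.≤-reflexive (sym (ℤP.*-identityˡ -[1+ n ]))
⟦⟧*≥-negPart false (+ n)    = ≤-refl
⟦⟧*≥-negPart false -[1+ n ] = -≤+

sumℤ≡sum : ∀ {n} (g : Fin n → ℤ) → sumℤ g ≡ sum g
sumℤ≡sum {ℕ.zero}  g = refl
sumℤ≡sum {ℕ.suc n} g = cong (_+_ (g zero)) (sumℤ≡sum (g ∘ suc))

sum-select : ∀ {n} (g : Fin n → ℤ) w a →
             sum (λ v → g v * (if does (w ≟F v) then a else 0ℤ)) ≡ g w * a
sum-select {ℕ.suc n} g zero a = begin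
  g zero * a + sum {n} (λ v → g (suc v) * 0ℤ) ≡⟨ cong (_+_ (g zero * a)) (sum-cong-≗ (ℤP.*-zeroʳ ∘ g ∘ suc)) ⟩
  g zero * a + sum {n} (λ _ → 0ℤ)           ≡⟨ cong (_+_ (g zero * a)) (sum-replicate-zero n) ⟩
  g zero * a + 0ℤ                          ≡⟨ ℤP.+-identityʳ _ ⟩
  g zero * a                               ∎
  where open ≡-Reasoning
sum-select {ℕ.suc n} g (suc w) a =
  trans (cong₂ _+_ (ℤP.*-zeroʳ (g zero)) (sum-select (g ∘ suc) w a)) (ℤP.+-identityˡ _)

sumℤ-≥-neg : ∀ {n} (g : Fin n → ℕ) (h : Fin n → ℤ) →
             (∀ i → - + g i ℤ.≤ h i) → - + sumℕ g ℤ.≤ sumℤ h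
sumℤ-≥-neg {ℕ.zero}  g h _ = ≤-refl
sumℤ-≥-neg {ℕ.suc n} g h g≤h =
  subst (ℤ._≤ sumℤ h) (sym neg-+-distrib)
    (+-mono-≤ (g≤h zero) (sumℤ-≥-neg (g ∘ suc) (h ∘ suc) (g≤h ∘ suc)))
  where
  neg-+-distrib : - + sumℕ g ≡ - + g zero + - + sumℕ (g ∘ suc)
  neg-+-distrib = ℤP.neg-distrib-+ (+ g zero) _

sumℤ≤0 : ∀ {n} (h : Fin n → ℤ) → (∀ i → h i ℤ.≤ 0ℤ) → sumℤ h ℤ.≤ 0ℤ
sumℤ≤0 {ℕ.zero}  h _   = ≤-refl
sumℤ≤0 {ℕ.suc n} h h≤0 = +-mono-≤ (h≤0 zero) (sumℤ≤0 (h ∘ suc) (h≤0 ∘ suc))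

sumℤ≤term : ∀ {n} (h : Fin n → ℤ) → (∀ i → h i ℤ.≤ 0ℤ) → ∀ i → sumℤ h ℤ.≤ h i
sumℤ≤term h h≤0 zero =
  subst (sumℤ h ℤ.≤_) (ℤP.+-identityʳ (h zero)) (+-mono-≤ (≤-refl {h zero}) (sumℤ≤0 (h ∘ suc) (h≤0 ∘ suc)))
sumℤ≤term h h≤0 (suc i) =
  subst (sumℤ h ℤ.≤_) (ℤP.+-identityˡ (h (suc i))) (+-mono-≤ (h≤0 zero) (sumℤ≤term (h ∘ suc) (h≤0 ∘ suc) i))

module _ (R : RealNumbers) where
  module ℝ = RealNumbers R
  open ℝ using (Carrier; 0#; fromℤ)
  open IsCommutativeRing ℝ.isCommutativeRing using (+-assoc; +-identityʳ)
  open IsStrictTotalOrder ℝ.isStrictTotalOrder using (_<?_; irrefl) renaming (trans to <-trans)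

  step : Carrier → Carrier → ℤ → Carrier
  step y δ σ = y ℝ.+ fromℤ σ ℝ.* δ

  module Order where
    open ℝ hiding (_+_; _*_; -_)
    open IsCommutativeRing isCommutativeRing using (+-comm; +-identityˡ; -‿inverseʳ; isRing)

    ring : Ring 0ℓ 0ℓ
    ring = record { isRing = isRing }
    open RingProperties ring using (-‿distribˡ-*)

    0<fromℕ-suc : ∀ n → 0# < fromℕ (ℕ.suc n)
    0<fromℕ-suc ℕ.zero    = subst (0# <_) (sym (+-identityʳ 1#)) 0<1
    0<fromℕ-suc (ℕ.suc n) =
      <-trans (0<fromℕ-suc n) (subst (_< 1# ℝ.+ fromℕ (ℕ.suc n)) (+-identityˡ _) (+-mono-< _ 0<1))

    x<x+pos : ∀ x {ε} → 0# < ε → x < x ℝ.+ ε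
    x<x+pos x {ε} 0<ε = subst₂ _<_ (+-identityˡ x) (+-comm ε x) (+-mono-< x 0<ε)

    x-pos<x : ∀ x {ε} → 0# < ε → x ℝ.+ ℝ.- ε < x
    x-pos<x x {ε} 0<ε = subst₂ _<_ (+-comm (ℝ.- ε) x) (+-identityˡ x) (+-mono-< x -ε<0)
      where
      -ε<0 : ℝ.- ε < 0#
      -ε<0 = subst₂ _<_ (+-identityˡ (ℝ.- ε)) (-‿inverseʳ ε) (+-mono-< (ℝ.- ε) 0<ε)

    step-up : ∀ y {δ} n → 0# < δ → y < step y δ +[1+ n ]
    step-up y n 0<δ = x<x+pos y (*-pos (0<fromℕ-suc n) 0<δ)

    step-down : ∀ y {δ} n → 0# < δ → step y δ -[1+ n ] < y
    step-down y {δ} n 0<δ =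
      subst (λ t → y ℝ.+ t < y) (-‿distribˡ-* (fromℕ (ℕ.suc n)) δ) (x-pos<x y (*-pos (0<fromℕ-suc n) 0<δ))

  open Order using (step-up; step-down)

  above : Carrier → Carrier → ℤ
  above c y = ⟦ isYes (c <? y) ⟧

  above-mono : ∀ c {y y′} → y ℝ.< y′ → True (c <? y) → True (c <? y′)
  above-mono c {y} {y′} y<y′ c<y = fromWitness {a? = c <? y′} (<-trans (toWitness {a? = c <? y} c<y) y<y′)

  above*≥-negPart : ∀ c y z → - + negPart z ℤ.≤ above c y * z
  above*≥-negPart c y = ⟦⟧*≥-negPart (isYes (c <? y))

  crossing : Carrier → Carrier → Carrier → ℤ → ℤ
  crossing c y δ σ = (above c y - above c (step y δ σ)) * σ

  crossing≤0 : ∀ c y {δ} σ → 0# ℝ.< δ → crossing c y δ σ ℤ.≤ 0ℤ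
  crossing≤0 c y {δ} (+ 0)    _   = ℤP.≤-reflexive (ℤP.*-zeroʳ (above c y - above c (step y δ (+ 0))))
  crossing≤0 c y     +[1+ n ] 0<δ = ⟦⟧-diff*pos≤0 (ℕ.suc n) (above-mono c (step-up y n 0<δ))
  crossing≤0 c y     -[1+ n ] 0<δ = ⟦⟧-diff*neg≤0 n (above-mono c (step-down y n 0<δ))

  above-self : ∀ y → above y y ≡ 0ℤ
  above-self y with y <? y
  ... | yes y<y = ⊥-elim (irrefl refl y<y)
  ... | no  _   = refl

  above-< : ∀ {c y} → c ℝ.< y → above c y ≡ 1ℤ
  above-< {c} {y} c<y with c <? y
  ... | yes _   = refl
  ... | no  c≮y = ⊥-elim (c≮y c<y)

  crossing-at : ∀ y {δ} σ → 0# ℝ.< δ → ∃ λ c → crossing c y δ σ ≡ - + ∣ σ ∣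
  crossing-at y {δ} (+ 0) _ = y , ℤP.*-zeroʳ (above y y - above y (step y δ (+ 0)))
  crossing-at y {δ} +[1+ n ] 0<δ = y , (begin
    (above y y - above y (step y δ +[1+ n ])) * +[1+ n ]
      ≡⟨ cong₂ (λ a b → (a - b) * +[1+ n ]) (above-self y) (above-< (step-up y n 0<δ)) ⟩
    ℤ.-1ℤ * +[1+ n ]
      ≡⟨ ℤP.-1*i≡-i +[1+ n ] ⟩
    - +[1+ n ] ∎)
    where open ≡-Reasoning
  crossing-at y {δ} -[1+ n ] 0<δ = step y δ -[1+ n ] , (begin
    (above c y - above c c) * -[1+ n ]  ≡⟨ cong₂ (λ a b → (a - b) * -[1+ n ]) (above-< (step-down y n 0<δ)) (above-self c) ⟩
    1ℤ * -[1+ n ]                       ≡⟨ ℤP.*-identityˡ -[1+ n ] ⟩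
    -[1+ n ]                            ∎)
    where
    open ≡-Reasoning
    c = step y δ -[1+ n ]

  -- c is the level and y the value of f at the start of the pieces.
  crossings : Carrier → Carrier → Pieces R → ℤ
  crossings c y []             = 0ℤ
  crossings c y ((δ , σ) ∷ ps) = crossing c y δ σ + crossings c (step y δ σ) ps

  -- Breakpoint terms [f(P) > c]·ord_P f at the interior breakpoints P.
  breakpoints : Carrier → Carrier → Pieces R → ℤ
  breakpoints c y []                        = 0ℤ
  breakpoints c y (_ ∷ [])                  = 0ℤ
  breakpoints c y ((δ , σ) ∷ (δ′ , σ′) ∷ ps) =
    above c (step y δ σ) * (σ′ - σ) + breakpoints c (step y δ σ) ((δ′ , σ′) ∷ ps)

  crossings-telescope : ∀ c y ps →
    crossings c y ps ≡ above c y * firstSlope R ps + above c (y ℝ.+ increment R ps) * - lastSlope R ps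
                       + breakpoints c y ps
  crossings-telescope c y [] = solve 2 (λ a b → con 0ℤ := a :* con 0ℤ :+ b :* (:- con 0ℤ) :+ con 0ℤ) refl
                                 (above c y) (above c (y ℝ.+ 0#))
    where open +-*-Solver
  crossings-telescope c y ((δ , σ) ∷ []) = begin
    (a - b) * σ + 0ℤ                ≡⟨ solve 3 (λ a b σ → (a :- b) :* σ :+ con 0ℤ := a :* σ :+ b :* (:- σ) :+ con 0ℤ) refl a b σ ⟩
    a * σ + b * - σ + 0ℤ            ≡⟨ cong (λ t → a * σ + above c t * - σ + 0ℤ) (sym (cong (y ℝ.+_) (+-identityʳ _))) ⟩
    a * σ + above c (y ℝ.+ (fromℤ σ ℝ.* δ ℝ.+ 0#)) * - σ + 0ℤ ∎
    where
    open ≡-Reasoning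
    open +-*-Solver
    a = above c y
    b = above c (step y δ σ)
  crossings-telescope c y ((δ , σ) ∷ q@(δ′ , σ′) ∷ ps) = begin
    (a - b) * σ + crossings c y′ (q ∷ ps)
      ≡⟨ cong (_+_ ((a - b) * σ)) (crossings-telescope c y′ (q ∷ ps)) ⟩
    (a - b) * σ + (b * σ′ + above c (y′ ℝ.+ I) * - L + B)
      ≡⟨ solve 7 (λ a b σ σ′ e L B → (a :- b) :* σ :+ (b :* σ′ :+ e :* (:- L) :+ B)
                                     := a :* σ :+ e :* (:- L) :+ (b :* (σ′ :- σ) :+ B))
               refl a b σ σ′ (above c (y′ ℝ.+ I)) L B ⟩
    a * σ + above c (y′ ℝ.+ I) * - L + (b * (σ′ - σ) + B)
      ≡⟨ cong (λ t → a * σ + above c t * - L + (b * (σ′ - σ) + B)) (+-assoc y _ I) ⟩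
    a * σ + above c (y ℝ.+ (fromℤ σ ℝ.* δ ℝ.+ I)) * - L + (b * (σ′ - σ) + B) ∎
    where
    open ≡-Reasoning
    open +-*-Solver
    y′ = step y δ σ
    a = above c y
    b = above c y′
    I = increment R (q ∷ ps)
    L = lastSlope R (q ∷ ps)
    B = breakpoints c y′ (q ∷ ps)

  breakpoints≥ : ∀ c y ps → - + interiorPoles R ps ℤ.≤ breakpoints c y ps
  breakpoints≥ c y []                        = ≤-refl
  breakpoints≥ c y (_ ∷ [])                  = ≤-refl
  breakpoints≥ c y ((δ , σ) ∷ (δ′ , σ′) ∷ ps) =
    subst (ℤ._≤ breakpoints c y ((δ , σ) ∷ (δ′ , σ′) ∷ ps)) (sym (ℤP.neg-distrib-+ (+ negPart (σ′ - σ)) _))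
      (+-mono-≤ (above*≥-negPart c (step y δ σ) (σ′ - σ)) (breakpoints≥ c (step y δ σ) ((δ′ , σ′) ∷ ps)))

  PositiveLengths : Pieces R → Set
  PositiveLengths = All (λ piece → 0# ℝ.< proj₁ piece)

  crossings≤0 : ∀ c y ps → PositiveLengths ps → crossings c y ps ℤ.≤ 0ℤ
  crossings≤0 c y []             []             = ≤-refl
  crossings≤0 c y ((δ , σ) ∷ ps) (0<δ ∷ ps-pos) =
    +-mono-≤ (crossing≤0 c y σ 0<δ) (crossings≤0 c (step y δ σ) ps ps-pos)

  crossings-at-first-piece : ∀ {δ s ps} → 0# ℝ.< δ → PositiveLengths ps →
                             ∀ y → ∃ λ c → crossings c y ((δ , s) ∷ ps) ℤ.≤ - + ∣ s ∣
  crossings-at-first-piece {δ} {s} {ps} 0<δ ps-pos y with c , exact ← crossing-at y s 0<δ =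
    c , subst (crossings c y ((δ , s) ∷ ps) ℤ.≤_) (ℤP.+-identityʳ _) (+-mono-≤ (ℤP.≤-reflexive exact) (crossings≤0 c _ ps ps-pos))

  crossings-at-slope : ∀ {ps x s} → PositiveLengths ps → DiffSlope R ps x s →
                       ∀ y → ∃ λ c → crossings c y ps ℤ.≤ - + ∣ s ∣
  crossings-at-slope (0<δ ∷ ps-pos) (inside _ _) y = crossings-at-first-piece 0<δ ps-pos y
  crossings-at-slope (0<δ ∷ ps-pos) (break _)    y = crossings-at-first-piece 0<δ ps-pos y
  crossings-at-slope {(δ , σ) ∷ ps} (0<δ ∷ ps-pos) (later _ slope) y
    with c , rest≤ ← crossings-at-slope ps-pos slope (step y δ σ) =
    c , subst (crossings c y ((δ , σ) ∷ ps) ℤ.≤_) (ℤP.+-identityˡ _) (+-mono-≤ (crossing≤0 c y σ 0<δ) rest≤)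

  module _ {Γ : MetricGraph R} (f : RationalFunction R Γ) where
    open MetricGraph Γ
    open Graph graph
    open RationalFunction f

    ∑-weighted-ordVertex : (g : Fin V → ℤ) →
      sumℤ (λ v → g v * ordVertex R f v)
        ≡ sumℤ (λ e → g (src e) * firstSlope R (pieces e) + g (tgt e) * - lastSlope R (pieces e))
    ∑-weighted-ordVertex g = begin
      sumℤ (λ v → g v * ordVertex R f v)
        ≡⟨ sumℤ≡sum (λ v → g v * ordVertex R f v) ⟩
      sum {V} (λ v → g v * sumℤ (λ e → A e v + B e v))
        ≡⟨ sum-cong-≗ (λ v → cong (g v *_) (sumℤ≡sum (λ e → A e v + B e v))) ⟩
      sum {V} (λ v → g v * sum (λ e → A e v + B e v))
        ≡⟨ sum-cong-≗ (λ v → *-distribˡ-sum (g v) (λ e → A e v + B e v)) ⟩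
      sum {V} (λ v → sum {E} (λ e → g v * (A e v + B e v)))
        ≡⟨ ∑-comm (λ v e → g v * (A e v + B e v)) ⟩
      sum {E} (λ e → sum {V} (λ v → g v * (A e v + B e v)))
        ≡⟨ sum-cong-≗ (λ e → sum-cong-≗ (λ v → ℤP.*-distribˡ-+ (g v) (A e v) (B e v))) ⟩
      sum {E} (λ e → sum {V} (λ v → g v * A e v + g v * B e v))
        ≡⟨ sum-cong-≗ (λ e → ∑-distrib-+ (λ v → g v * A e v) (λ v → g v * B e v)) ⟩
      sum {E} (λ e → sum {V} (λ v → g v * A e v) + sum {V} (λ v → g v * B e v))
        ≡⟨ sum-cong-≗ (λ e → cong₂ _+_ (sum-select g (src e) _) (sum-select g (tgt e) _)) ⟩
      sum ends
        ≡⟨ sumℤ≡sum ends ⟨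
      sumℤ ends ∎
      where
      open ≡-Reasoning
      A B : Fin E → Fin V → ℤ
      A e v = if does (src e ≟F v) then firstSlope R (pieces e) else 0ℤ
      B e v = if does (tgt e ≟F v) then - lastSlope R (pieces e) else 0ℤ
      ends : Fin E → ℤ
      ends e = g (src e) * firstSlope R (pieces e) + g (tgt e) * - lastSlope R (pieces e)

    totalCrossings : Carrier → ℤ
    totalCrossings c = sumℤ (λ e → crossings c (value (src e)) (pieces e))

    totalCrossings≡ : ∀ c → totalCrossings c
      ≡ sumℤ (λ v → above c (value v) * ordVertex R f v) + sumℤ (λ e → breakpoints c (value (src e)) (pieces e))
    totalCrossings≡ c = begin
      sumℤ (λ e → crossings c (value (src e)) (pieces e))
        ≡⟨ sumℤ≡sum (λ e → crossings c (value (src e)) (pieces e)) ⟩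
      sum {E} (λ e → crossings c (value (src e)) (pieces e))
        ≡⟨ sum-cong-≗ telescoped ⟩
      sum {E} (λ e → ends e + breaks e)
        ≡⟨ ∑-distrib-+ ends breaks ⟩
      sum ends + sum breaks
        ≡⟨ cong₂ _+_ (sym (sumℤ≡sum ends)) (sym (sumℤ≡sum breaks)) ⟩
      sumℤ ends + sumℤ breaks
        ≡⟨ cong (_+ sumℤ breaks) (sym (∑-weighted-ordVertex (λ v → above c (value v)))) ⟩
      sumℤ (λ v → above c (value v) * ordVertex R f v) + sumℤ breaks ∎
      where
      open ≡-Reasoning
      ends breaks : Fin E → ℤ
      ends e = above c (value (src e)) * firstSlope R (pieces e) + above c (value (tgt e)) * - lastSlope R (pieces e)
      breaks e = breakpoints c (value (src e)) (pieces e)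

      telescoped : ∀ e → crossings c (value (src e)) (pieces e) ≡ ends e + breaks e
      telescoped e = trans (crossings-telescope c _ (pieces e))
        (cong (λ t → above c (value (src e)) * firstSlope R (pieces e) + above c t * - lastSlope R (pieces e) + breaks e)
              (sym (continuous e)))

    totalCrossings≥ : ∀ c → - + numPoles R f ℤ.≤ totalCrossings c
    totalCrossings≥ c = begin
      - + numPoles R f
        ≡⟨ ℤP.neg-distrib-+ (+ sumℕ vertexPoles) (+ sumℕ edgePoles) ⟩
      - + sumℕ vertexPoles + - + sumℕ edgePoles
        ≤⟨ +-mono-≤ (sumℤ-≥-neg vertexPoles _ (λ v → above*≥-negPart c (value v) (ordVertex R f v)))
                    (sumℤ-≥-neg edgePoles _ (λ e → breakpoints≥ c (value (src e)) (pieces e))) ⟩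
      sumℤ (λ v → above c (value v) * ordVertex R f v) + sumℤ (λ e → breakpoints c (value (src e)) (pieces e))
        ≡⟨ totalCrossings≡ c ⟨
      totalCrossings c ∎
      where
      open ℤP.≤-Reasoning
      vertexPoles : Fin V → ℕ
      edgePoles : Fin E → ℕ
      vertexPoles v = negPart (ordVertex R f v)
      edgePoles e = interiorPoles R (pieces e)

    ∣slope∣≤numPoles : ∀ e x s → SlopeAt R f e x s → ∣ s ∣ ≤ numPoles R f
    ∣slope∣≤numPoles e x s slope
      with c , crossings≤ ← crossings-at-slope (pieces-pos e) slope (value (src e)) =
      ℤP.drop‿+≤+ (ℤP.neg-cancel-≤ (begin
        - + numPoles R f                        ≤⟨ totalCrossings≥ c ⟩
        totalCrossings c                        ≤⟨ sumℤ≤term _ (λ e′ → crossings≤0 c _ (pieces e′) (pieces-pos e′)) e ⟩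
        crossings c (value (src e)) (pieces e)  ≤⟨ crossings≤ ⟩
        - + ∣ s ∣                               ∎))
      where open ℤP.≤-Reasoning

lemma1p8 : (R : RealNumbers) (p : ℕ) → p > 0 → (G : Graph) → Connected G →
    ∃ λ (B : ℕ) →
      (Γ : MetricGraph R) → MetricGraph.graph Γ ≡ G →
      (f : RationalFunction R Γ) → numPoles R f ≤ p →
      ∀ e x s → SlopeAt R f e x s → ∣ s ∣ ≤ B
lemma1p8 R p _ _ _ = p , λ _ _ f poles≤p e x s slope →
  ℕP.≤-trans (∣slope∣≤numPoles R f e x s slope) poles≤p
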